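{- For every positive integer $n$, \[ p(n) = \big|\{ a \in \{0,1,\dots,n^2\} : \mathcal{N}(4\cdot a!) \le 2^n \}\big| . \]
   Context: $p(n)$ denotes the $n$-th prime number ($p(1)=2$); $0!=1$. For $m>0$, $\mathcal{N}(m)=|\{a\in\{0,\dots,m-1\}: a^2\equiv 1 \pmod m\}|$. -}

module Defs where

open import Data.Nat using (ℕ; zero; suc; _*_; _^_; _∸_; _≤_; _≤?_; _≟_; _%_; _!; NonZero)
open import Data.Nat.Properties using (m*n≢0; _!≢0)
open import Data.Nat.Primality using (Prime; prime?)
open import Data.List using (List; length; filter; upTo)
open import Data.Product using (_×_)
open import Relation.Binary.PropositionalEquality using (_≡_)

primesBelow : ℕ → ℕ
primesBelow m = length (filter prime? (upTo m))

-- q is the n-th prime p(n) (1-indexed, p(1) = 2), for n ≥ 1: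
-- q is prime and exactly n - 1 primes lie below q
IsNthPrime : ℕ → ℕ → Set
IsNthPrime n q = Prime q × primesBelow q ≡ n ∸ 1

𝒩 : (m : ℕ) → .{{NonZero m}} → ℕ
𝒩 m = length (filter (λ a → (a * a) % m ≟ 1 % m) (upTo m))

4a!-nonZero : (a : ℕ) → NonZero (4 * (a !))
4a!-nonZero a = m*n≢0 4 (a !) {{_}} {{a !≢0}}

countA : ℕ → ℕ
countA n = length (filter (λ a → 𝒩 (4 * (a !)) {{4a!-nonZero a}} ≤? 2 ^ n) (upTo (suc (n * n))))

{-# OPTIONS --safe #-}

-- Splitting x < m * p as t * m + y, the roots
-- modulo m * p lie over roots y modulo m, and the lifts of a root y are counted by linear congruences in t
-- modulo p: a new odd prime p doubles the count (one lift for each of x ≡ ±1 mod p), an odd prime already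
-- dividing m keeps it (one lift), and so does p = 2 once 8 ∣ m. Building 4 * a! one prime factor at a time
-- gives 𝒩(4 * a!) = 2^(π(a) + 1), where π(a) counts the primes ≤ a. Hence 𝒩(4 * a!) ≤ 2ⁿ iff π(a) < n iff
-- a < p(n), and the count over a ≤ n² is p(n) as soon as n ≤ π(n² + 1). This holds by evaluation for n < 16
-- and for n ≥ 16 by Chebyshev's bound 2^m ≤ (2m choose m) ≤ (2m)^π(2m), where Legendre's formula shows
-- that the prime powers dividing (2m choose m) are at most 2m.

module Submission where

open import Defs
open import Data.Nat
open import Data.Nat.Properties
open import Data.Nat.DivMod
open import Data.Nat.Divisibility
open import Data.Nat.Coprimality using (Coprime; coprime-divisor; coprime-Bézout) renaming (sym to Coprime-sym)
open import Data.Nat.GCD using (module Bézout)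
open import Data.Nat.Primality using (Prime; prime?; ¬prime[1]; prime⇒nonZero; prime⇒nonTrivial; prime⇒irreducible; euclidsLemma)
open import Data.Nat.Primality.Factorisation using (factorise; PrimeFactorisation)
open import Data.Nat.Combinatorics using (_C_; k![n∸k]!∣n!)
open import Data.Nat.Combinatorics.Specification using (nCk≡n!/k![n-k]!)
open import Data.Nat.Induction using (<-wellFounded)
open import Data.Nat.ListAction using (product)
open import Data.Nat.ListAction.Properties using (∈⇒∣product)
open import Data.Nat.Tactic.RingSolver using (solve-∀)
open import Data.List using ([]; _∷_; length; filter; upTo; _++_)
open import Data.List.Properties using (length-++; filter-++; upTo-∷ʳ)
open import Data.List.Relation.Unary.All using (All; []; _∷_; all?; lookup)
open import Data.List.Relation.Unary.Any using (here; there)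
open import Data.List.Membership.Propositional using (_∈_)
open import Data.List.Membership.Propositional.Properties using (∈-upTo⁺)
open import Data.Product using (∃-syntax; _×_; _,_)
open import Data.Sum using (_⊎_; inj₁; inj₂; [_,_]) renaming (map to ⊎-map)
open import Function using (id; _∘_; it; _⇔_; mk⇔; Equivalence)
open import Function.Construct.Composition using (_⇔-∘_)
open import Induction.WellFounded using (Acc; acc)
open import Level using (Level)
open import Relation.Nullary using (Dec; yes; no; ¬_; contradiction)
open import Relation.Nullary.Decidable using (toWitness)
open import Relation.Unary using (Pred; Decidable)
open import Relation.Binary.PropositionalEquality hiding ([_])

open Equivalence using (to; from)

private variable
  ℓ : Level
  P Q R : Set ℓ

∑ : ℕ → (ℕ → ℕ) → ℕ
∑ zero    f = 0
∑ (suc n) f = ∑ n f + f n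

syntax ∑ n (λ i → e) = ∑[ i < n ] e

∑-cong : ∀ n {f g : ℕ → ℕ} → (∀ {i} → i < n → f i ≡ g i) → ∑ n f ≡ ∑ n g
∑-cong zero    f≡g = refl
∑-cong (suc n) f≡g = cong₂ _+_ (∑-cong n (f≡g ∘ m<n⇒m<1+n)) (f≡g ≤-refl)

∑-mono-≤ : ∀ n {f g : ℕ → ℕ} → (∀ {i} → i < n → f i ≤ g i) → ∑ n f ≤ ∑ n g
∑-mono-≤ zero    f≤g = z≤n
∑-mono-≤ (suc n) f≤g = +-mono-≤ (∑-mono-≤ n (λ i<n → f≤g (m<n⇒m<1+n i<n))) (f≤g ≤-refl)

∑-const : ∀ n c → ∑[ i < n ] c ≡ n * c
∑-const zero    c = refl
∑-const (suc n) c = trans (cong (_+ c) (∑-const n c)) (+-comm (n * c) c)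

∑-zero : ∀ n → ∑[ i < n ] 0 ≡ 0
∑-zero n = trans (∑-const n 0) (*-zeroʳ n)

∑-one : ∀ n → ∑[ i < n ] 1 ≡ n
∑-one n = trans (∑-const n 1) (*-identityʳ n)

∑-distrib-+ : ∀ n (f g : ℕ → ℕ) → ∑[ i < n ] (f i + g i) ≡ ∑ n f + ∑ n g
∑-distrib-+ zero    f g = refl
∑-distrib-+ (suc n) f g = begin
  ∑[ i < n ] (f i + g i) + (f n + g n) ≡⟨ cong (_+ (f n + g n)) (∑-distrib-+ n f g) ⟩
  ∑ n f + ∑ n g + (f n + g n)          ≡⟨ +-assoc (∑ n f) (∑ n g) (f n + g n) ⟩
  ∑ n f + (∑ n g + (f n + g n))        ≡⟨ cong (∑ n f +_) (x+[y+z]≡y+[x+z] (∑ n g) (f n) (g n)) ⟩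
  ∑ n f + (f n + (∑ n g + g n))        ≡⟨ +-assoc (∑ n f) (f n) (∑ n g + g n) ⟨
  ∑ n f + f n + (∑ n g + g n)          ∎
  where
  open ≡-Reasoning
  x+[y+z]≡y+[x+z] : ∀ x y z → x + (y + z) ≡ y + (x + z)
  x+[y+z]≡y+[x+z] x y z = trans (sym (+-assoc x y z)) (trans (cong (_+ z) (+-comm x y)) (+-assoc y x z))

∑-distribˡ-* : ∀ n c (f : ℕ → ℕ) → ∑[ i < n ] (c * f i) ≡ c * ∑ n f
∑-distribˡ-* zero    c f = sym (*-zeroʳ c)
∑-distribˡ-* (suc n) c f = trans (cong (_+ c * f n) (∑-distribˡ-* n c f)) (sym (*-distribˡ-+ c (∑ n f) (f n)))

∑-+ : ∀ m n (f : ℕ → ℕ) → ∑ (m + n) f ≡ ∑ m f + ∑[ i < n ] f (m + i)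
∑-+ m zero    f = trans (cong (λ k → ∑ k f) (+-identityʳ m)) (sym (+-identityʳ (∑ m f)))
∑-+ m (suc n) f = begin
  ∑ (m + suc n) f                                ≡⟨ cong (λ k → ∑ k f) (+-suc m n) ⟩
  ∑ (m + n) f + f (m + n)                        ≡⟨ cong (_+ f (m + n)) (∑-+ m n f) ⟩
  ∑ m f + ∑[ i < n ] f (m + i) + f (m + n)       ≡⟨ +-assoc (∑ m f) _ _ ⟩
  ∑ m f + (∑[ i < n ] f (m + i) + f (m + n))     ∎
  where open ≡-Reasoning

∑-comm : ∀ m n (f : ℕ → ℕ → ℕ) → ∑[ i < m ] ∑[ j < n ] f i j ≡ ∑[ j < n ] ∑[ i < m ] f i j
∑-comm zero    n f = sym (∑-zero n)
∑-comm (suc m) n f = trans (cong (_+ ∑[ j < n ] f m j) (∑-comm m n f))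
                           (sym (∑-distrib-+ n (λ j → ∑[ i < m ] f i j) (f m)))

∑-fibres : ∀ m p (f : ℕ → ℕ) → ∑ (m * p) f ≡ ∑[ y < m ] ∑[ t < p ] f (t * m + y)
∑-fibres m p f = trans (blocks p) (∑-comm p m (λ t y → f (t * m + y)))
  where
  blocks : ∀ p → ∑ (m * p) f ≡ ∑[ t < p ] ∑[ y < m ] f (t * m + y)
  blocks zero    = cong (λ k → ∑ k f) (*-zeroʳ m)
  blocks (suc p) = begin
    ∑ (m * suc p) f                                  ≡⟨ cong (λ k → ∑ k f) (trans (*-suc m p) (+-comm m (m * p))) ⟩
    ∑ (m * p + m) f                                  ≡⟨ ∑-+ (m * p) m f ⟩
    ∑ (m * p) f + ∑[ y < m ] f (m * p + y)           ≡⟨ cong₂ _+_ (blocks p) (∑-cong m (λ {y} _ → cong (λ k → f (k + y)) mp≡pm)) ⟩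
    ∑[ t < p ] ∑[ y < m ] f (t * m + y) + ∑[ y < m ] f (p * m + y) ∎
    where
    open ≡-Reasoning
    mp≡pm : m * p ≡ p * m
    mp≡pm = *-comm m p

𝟙 : Dec P → ℕ
𝟙 (yes _) = 1
𝟙 (no  _) = 0

𝟙-yes : (P? : Dec P) → P → 𝟙 P? ≡ 1
𝟙-yes (yes _) _ = refl
𝟙-yes (no ¬p) p = contradiction p ¬p

𝟙-no : (P? : Dec P) → ¬ P → 𝟙 P? ≡ 0
𝟙-no (yes p) ¬p = contradiction p ¬p
𝟙-no (no _)  _  = refl

𝟙-cong : (P? : Dec P) (Q? : Dec Q) → P ⇔ Q → 𝟙 P? ≡ 𝟙 Q?
𝟙-cong (yes _) (yes _) _   = refl
𝟙-cong (no _)  (no _)  _   = refl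
𝟙-cong (yes p) (no ¬q) P⇔Q = contradiction (to P⇔Q p) ¬q
𝟙-cong (no ¬p) (yes q) P⇔Q = contradiction (from P⇔Q q) ¬p

𝟙≤1 : (P? : Dec P) → 𝟙 P? ≤ 1
𝟙≤1 (yes _) = s≤s z≤n
𝟙≤1 (no _)  = z≤n

𝟙-⊎ : (R? : Dec R) (P? : Dec P) (Q? : Dec Q) → R ⇔ (P ⊎ Q) → ¬ (P × Q) → 𝟙 R? ≡ 𝟙 P? + 𝟙 Q?
𝟙-⊎ R? (yes p) (yes q) _ disjoint = contradiction (p , q) disjoint
𝟙-⊎ R? (yes p) (no _)  R⇔P⊎Q _ = 𝟙-yes R? (from R⇔P⊎Q (inj₁ p))
𝟙-⊎ R? (no _)  (yes q) R⇔P⊎Q _ = 𝟙-yes R? (from R⇔P⊎Q (inj₂ q))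
𝟙-⊎ R? (no ¬p) (no ¬q) R⇔P⊎Q _ = 𝟙-no R? λ r → [ ¬p , ¬q ] (to R⇔P⊎Q r)

module _ {P : Pred ℕ ℓ} (P? : Decidable P) where

  count : ℕ → ℕ
  count n = ∑[ i < n ] 𝟙 (P? i)

  length-filter-upTo : ∀ n → length (filter P? (upTo n)) ≡ count n
  length-filter-upTo zero    = refl
  length-filter-upTo (suc n) = begin
    length (filter P? (upTo (suc n)))                       ≡⟨ cong (length ∘ filter P?) (upTo-∷ʳ n) ⟨
    length (filter P? (upTo n ++ (n ∷ [])))                    ≡⟨ cong length (filter-++ P? (upTo n) (n ∷ [])) ⟩
    length (filter P? (upTo n) ++ filter P? (n ∷ []))          ≡⟨ length-++ (filter P? (upTo n)) ⟩
    length (filter P? (upTo n)) + length (filter P? (n ∷ []))  ≡⟨ cong₂ _+_ (length-filter-upTo n) (length-filter-[x] (P? n)) ⟩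
    count (suc n)                                           ∎
    where
    open ≡-Reasoning
    length-filter-[x] : (Pn? : Dec (P n)) → length (filter P? (n ∷ [])) ≡ 𝟙 (P? n)
    length-filter-[x] _ with P? n
    ... | yes _ = refl
    ... | no  _ = refl

  count-none : ∀ n → (∀ {i} → i < n → ¬ P i) → count n ≡ 0
  count-none n ¬P = trans (∑-cong n (λ i<n → 𝟙-no (P? _) (¬P i<n))) (∑-zero n)

  count-all : ∀ n → (∀ {i} → i < n → P i) → count n ≡ n
  count-all n allP = trans (∑-cong n (λ i<n → 𝟙-yes (P? _) (allP i<n))) (∑-one n)

  count-unique : ∀ n {i} → i < n → P i → (∀ {j} → j < n → P j → j ≡ i) → count n ≡ 1
  count-unique (suc n) {i} i<1+n Pi unique with i ≟ n
  ... | yes refl = cong₂ _+_ (count-none n (λ j<n Pj → <-irrefl (unique (m<n⇒m<1+n j<n) Pj) j<n)) (𝟙-yes (P? n) Pi)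
  ... | no  i≢n  = trans (cong₂ _+_ (count-unique n (≤∧≢⇒< (s≤s⁻¹ i<1+n) i≢n) Pi (unique ∘ m<n⇒m<1+n))
                                    (𝟙-no (P? n) (λ Pn → i≢n (sym (unique ≤-refl Pn)))))
                         (+-identityʳ 1)

  count-≤ : ∀ n → count n ≤ n
  count-≤ n = ≤-trans (∑-mono-≤ n (λ _ → 𝟙≤1 (P? _))) (≤-reflexive (∑-one n))

  count-downClosed : (∀ {a b} → a ≤ b → P b → P a) → ∀ L → ¬ P L →
                     ¬ P (count L) × (∀ {a} → a < count L → P a)
  count-downClosed downClosed zero    ¬PL = ¬PL , λ ()
  count-downClosed downClosed (suc L) ¬P[1+L] with P? L
  ... | yes PL = subst (λ q → ¬ P q × (∀ {a} → a < q → P a)) (sym count[1+L]≡1+L)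
                       (¬P[1+L] , λ a<1+L → downClosed (s≤s⁻¹ a<1+L) PL)
    where
    count[1+L]≡1+L : count L + 1 ≡ suc L
    count[1+L]≡1+L = trans (cong (_+ 1) (count-all L (λ a<L → downClosed (<⇒≤ a<L) PL))) (+-comm L 1)
  ... | no ¬PL = subst (λ q → ¬ P q × (∀ {a} → a < q → P a)) (sym (+-identityʳ (count L)))
                       (count-downClosed downClosed L ¬PL)

  count-mono-≤ : ∀ {m n} → m ≤ n → count m ≤ count n
  count-mono-≤ {m} {n} m≤n = begin
    count m                                        ≤⟨ m≤m+n (count m) _ ⟩
    count m + ∑[ i < n ∸ m ] 𝟙 (P? (m + i))        ≡⟨ ∑-+ m (n ∸ m) (λ i → 𝟙 (P? i)) ⟨
    count (m + (n ∸ m))                            ≡⟨ cong count (m+[n∸m]≡n m≤n) ⟩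
    count n                                        ∎
    where open ≤-Reasoning

count-cong : ∀ {P Q : Pred ℕ ℓ} (P? : Decidable P) (Q? : Decidable Q) n →
             (∀ {i} → i < n → P i ⇔ Q i) → count P? n ≡ count Q? n
count-cong P? Q? n P⇔Q = ∑-cong n (λ i<n → 𝟙-cong (P? _) (Q? _) (P⇔Q i<n))

count-fibres : ∀ {P Q : Pred ℕ ℓ} (P? : Decidable P) (Q? : Decidable Q) m p k →
               (∀ {y} → y < m → count (λ t → P? (t * m + y)) p ≡ k * 𝟙 (Q? y)) →
               count P? (m * p) ≡ k * count Q? m
count-fibres P? Q? m p k fibre = begin
  count P? (m * p)                               ≡⟨ ∑-fibres m p (λ x → 𝟙 (P? x)) ⟩
  ∑[ y < m ] count (λ t → P? (t * m + y)) p      ≡⟨ ∑-cong m fibre ⟩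
  ∑[ y < m ] (k * 𝟙 (Q? y))                      ≡⟨ ∑-distribˡ-* m k (λ y → 𝟙 (Q? y)) ⟩
  k * count Q? m                                 ∎
  where open ≡-Reasoning

-- Linear congruences

∣n⇒[∣m+n⇔∣m] : ∀ {d m n} → d ∣ n → d ∣ m + n ⇔ d ∣ m
∣n⇒[∣m+n⇔∣m] {d} {m} {n} d∣n = mk⇔ (λ d∣m+n → ∣m+n∣m⇒∣n (subst (d ∣_) (+-comm m n) d∣m+n) d∣n)
                                    (λ d∣m → ∣m∣n⇒∣m+n d∣m d∣n)

∣⇒≡0 : ∀ {d n} → d ∣ n → n < d → n ≡ 0
∣⇒≡0 {n = zero}  _   _   = refl
∣⇒≡0 {n = suc n} d∣n n<d = contradiction (∣⇒≤ d∣n) (<⇒≱ n<d)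

prime∤⇒coprime : ∀ {p a} → Prime p → ¬ p ∣ a → Coprime p a
prime∤⇒coprime p-prime p∤a (d∣p , d∣a) with prime⇒irreducible p-prime d∣p
... | inj₁ d≡1    = d≡1
... | inj₂ refl   = contradiction d∣a p∤a

coprime⇒*∣ : ∀ {m n a} → Coprime m n → m ∣ a → n ∣ a → m * n ∣ a
coprime⇒*∣ {m} {n} coprime m∣a (divides q refl) = *-monoˡ-∣ n (coprime-divisor coprime (subst (m ∣_) (*-comm q n) m∣a))

-- Bézout gives an inverse of a modulo n, which is scaled to a solution.
linear-congruence-solvable : ∀ {n a} c → .{{NonZero n}} → Coprime n a → ∃[ t ] n ∣ t * a + c
linear-congruence-solvable {suc n′} {a} c coprime with coprime-Bézout (Coprime-sym coprime)
... | Bézout.+- x y 1+yn≡xa = n′ * c * x , divides (c + n′ * c * y) (begin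
  n′ * c * x * a + c               ≡⟨ cong (_+ c) (*-assoc (n′ * c) x a) ⟩
  n′ * c * (x * a) + c             ≡⟨ cong (λ z → n′ * c * z + c) 1+yn≡xa ⟨
  n′ * c * (1 + y * suc n′) + c    ≡⟨ expand n′ c y ⟩
  (c + n′ * c * y) * suc n′        ∎)
  where
  open ≡-Reasoning
  expand : ∀ n′ c y → n′ * c * (1 + y * suc n′) + c ≡ (c + n′ * c * y) * suc n′
  expand = solve-∀
... | Bézout.-+ x y 1+xa≡yn = c * x , divides (c * y) (begin
  c * x * a + c                    ≡⟨ factor c x a ⟩
  c * (1 + x * a)                  ≡⟨ cong (c *_) 1+xa≡yn ⟩
  c * (y * suc n′)                 ≡⟨ *-assoc c y (suc n′) ⟨
  c * y * suc n′                   ∎)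
  where
  open ≡-Reasoning
  factor : ∀ c x a → c * x * a + c ≡ c * (1 + x * a)
  factor = solve-∀

linear-congruence-solvable< : ∀ {n a} c → .{{_ : NonZero n}} → Coprime n a → ∃[ t ] t < n × n ∣ t * a + c
linear-congruence-solvable< {n} {a} c coprime with linear-congruence-solvable c coprime
... | t , n∣ta+c = t % n , m%n<n t n ,
  to (∣n⇒[∣m+n⇔∣m] (m∣m*n (t / n * a))) (subst (n ∣_) split n∣ta+c)
  where
  split : t * a + c ≡ t % n * a + c + n * (t / n * a)
  split = begin
    t * a + c                              ≡⟨ cong (λ z → z * a + c) (m≡m%n+[m/n]*n t n) ⟩
    (t % n + t / n * n) * a + c            ≡⟨ rearrange (t % n) (t / n) n a c ⟩
    t % n * a + c + n * (t / n * a)        ∎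
    where
    open ≡-Reasoning
    rearrange : ∀ r q n a c → (r + q * n) * a + c ≡ r * a + c + n * (q * a)
    rearrange = solve-∀

linear-congruence-unique : ∀ {n a c t₁ t₂} → Coprime n a → t₁ ≤ t₂ → t₂ < n →
                           n ∣ t₁ * a + c → n ∣ t₂ * a + c → t₁ ≡ t₂
linear-congruence-unique {n} {a} {c} {t₁} {t₂} coprime t₁≤t₂ t₂<n n∣t₁a+c n∣t₂a+c = begin
  t₁          ≡⟨ +-identityʳ t₁ ⟨
  t₁ + 0      ≡⟨ cong (t₁ +_) d≡0 ⟨
  t₁ + d      ≡⟨ m+[n∸m]≡n t₁≤t₂ ⟩
  t₂          ∎
  where
  open ≡-Reasoning
  d = t₂ ∸ t₁
  t₂a+c≡t₁a+c+ad : t₂ * a + c ≡ (t₁ * a + c) + a * d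
  t₂a+c≡t₁a+c+ad = trans (cong (λ z → z * a + c) (sym (m+[n∸m]≡n t₁≤t₂))) (expand t₁ d a c)
    where
    expand : ∀ t₁ d a c → (t₁ + d) * a + c ≡ (t₁ * a + c) + a * d
    expand = solve-∀
  d≡0 : d ≡ 0
  d≡0 = ∣⇒≡0 (coprime-divisor coprime (∣m+n∣m⇒∣n (subst (n ∣_) t₂a+c≡t₁a+c+ad n∣t₂a+c) n∣t₁a+c))
             (≤-<-trans (m∸n≤m t₂ t₁) t₂<n)

linear-congruence : ∀ {n a} c → .{{_ : NonZero n}} → Coprime n a → count (λ t → n ∣? t * a + c) n ≡ 1
linear-congruence {n} {a} c coprime with linear-congruence-solvable< c coprime
... | t , t<n , n∣ta+c = count-unique (λ s → n ∣? s * a + c) n t<n n∣ta+c unique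
  where
  unique : ∀ {s} → s < n → n ∣ s * a + c → s ≡ t
  unique {s} s<n n∣sa+c with ≤-total s t
  ... | inj₁ s≤t = linear-congruence-unique coprime s≤t t<n n∣sa+c n∣ta+c
  ... | inj₂ t≤s = sym (linear-congruence-unique coprime t≤s s<n n∣ta+c n∣sa+c)

-- Square roots of 1 modulo m

-- x² ≡ 1 (mod m), stated as a divisibility so that no subtraction falls below zero.
SqrtOfOne : ℕ → ℕ → Set
SqrtOfOne m x = m ∣ x * x + (m ∸ 1)

sqrtOfOne? : ∀ m x → Dec (SqrtOfOne m x)
sqrtOfOne? m x = m ∣? x * x + (m ∸ 1)

sqrtsOfOne : ℕ → ℕ
sqrtsOfOne m = count (sqrtOfOne? m) m

%≡1%⇔∣+∸1 : ∀ x m .{{_ : NonZero m}} → x % m ≡ 1 % m ⇔ m ∣ x + (m ∸ 1)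
%≡1%⇔∣+∸1 x (suc m′) = mk⇔ ≡1⇒∣ ∣⇒≡1
  where
  m = suc m′
  ≡1⇒∣ : x % m ≡ 1 % m → m ∣ x + m′
  ≡1⇒∣ x%m≡1%m = m%n≡0⇒n∣m (x + m′) m (begin
    (x + m′) % m               ≡⟨ %-distribˡ-+ x m′ m ⟩
    (x % m + m′ % m) % m       ≡⟨ cong (λ r → (r + m′ % m) % m) x%m≡1%m ⟩
    (1 % m + m′ % m) % m       ≡⟨ %-distribˡ-+ 1 m′ m ⟨
    m % m                      ≡⟨ n%n≡0 m ⟩
    0                          ∎)
    where open ≡-Reasoning
  ∣⇒≡1 : m ∣ x + m′ → x % m ≡ 1 % m
  ∣⇒≡1 m∣x+m′ = begin
    x % m                      ≡⟨ [m+n]%n≡m%n x m ⟨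
    (x + m) % m                ≡⟨ cong (_% m) (trans (+-suc x m′) (+-comm 1 (x + m′))) ⟩
    (x + m′ + 1) % m           ≡⟨ %-distribˡ-+ (x + m′) 1 m ⟩
    ((x + m′) % m + 1 % m) % m ≡⟨ cong (λ r → (r + 1 % m) % m) (n∣m⇒m%n≡0 (x + m′) m m∣x+m′) ⟩
    1 % m % m                  ≡⟨ m%n%n≡m%n 1 m ⟩
    1 % m                      ∎
    where open ≡-Reasoning

𝒩≡sqrtsOfOne : ∀ m .{{_ : NonZero m}} → 𝒩 m ≡ sqrtsOfOne m
𝒩≡sqrtsOfOne m = trans (length-filter-upTo _ m)
                       (count-cong _ (sqrtOfOne? m) m (λ {x} _ → %≡1%⇔∣+∸1 (x * x) m))

sqrtOfOne-shift : ∀ {n} m t y → n ∣ 2 * m → n ∣ m * m → SqrtOfOne n (t * m + y) ⇔ SqrtOfOne n y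
sqrtOfOne-shift {n} m t y n∣2m n∣m² =
  subst (λ z → n ∣ z ⇔ SqrtOfOne n y) (sym (expand t m y (n ∸ 1))) (∣n⇒[∣m+n⇔∣m] n∣t[2my+tm²])
  where
  expand : ∀ t m y c → (t * m + y) * (t * m + y) + c ≡ (y * y + c) + t * (2 * m * y + t * (m * m))
  expand = solve-∀
  n∣t[2my+tm²] : n ∣ t * (2 * m * y + t * (m * m))
  n∣t[2my+tm²] = ∣n⇒∣m*n t (∣m∣n⇒∣m+n (∣m⇒∣m*n y n∣2m) (∣n⇒∣m*n t n∣m²))

sqrtOfOne-periodic : ∀ m t y → SqrtOfOne m (t * m + y) ⇔ SqrtOfOne m y
sqrtOfOne-periodic m t y = sqrtOfOne-shift m t y (n∣m*n 2) (m∣m*n m)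

*∸1 : ∀ m n .{{_ : NonZero m}} .{{_ : NonZero n}} → m * n ∸ 1 ≡ (m ∸ 1) + m * (n ∸ 1)
*∸1 (suc m′) (suc n′) = regroup m′ n′
  where
  regroup : ∀ m′ n′ → n′ + m′ * suc n′ ≡ m′ + suc m′ * n′
  regroup = solve-∀

∣[x²+mn∸1]⇔sqrtOfOne : ∀ m n x .{{_ : NonZero m}} .{{_ : NonZero n}} → m ∣ x * x + (m * n ∸ 1) ⇔ SqrtOfOne m x
∣[x²+mn∸1]⇔sqrtOfOne m n x = subst (λ z → m ∣ z ⇔ SqrtOfOne m x) regroup (∣n⇒[∣m+n⇔∣m] (m∣m*n (n ∸ 1)))
  where
  regroup : x * x + (m ∸ 1) + m * (n ∸ 1) ≡ x * x + (m * n ∸ 1)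
  regroup = trans (+-assoc (x * x) (m ∸ 1) _) (cong (x * x +_) (sym (*∸1 m n)))

sqrtOfOne-∣ : ∀ {d m} x .{{_ : NonZero m}} → d ∣ m → SqrtOfOne m x → SqrtOfOne d x
sqrtOfOne-∣ {d} {m} x d∣m@(divides q m≡qd) m∣ = to (∣[x²+mn∸1]⇔sqrtOfOne d q x {{d≢0}} {{q≢0}}) d∣
  where
  q≢0 : NonZero q
  q≢0 = m*n≢0⇒m≢0 q {{subst NonZero m≡qd it}}
  d≢0 : NonZero d
  d≢0 = m*n≢0⇒n≢0 q {{subst NonZero m≡qd it}}
  d∣ : d ∣ x * x + (d * q ∸ 1)
  d∣ = ∣-trans d∣m (subst (λ k → m ∣ x * x + (k ∸ 1)) (trans m≡qd (*-comm q d)) m∣)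

sqrtOfOne-* : ∀ {m n} x .{{_ : NonZero m}} .{{_ : NonZero n}} → Coprime m n →
              SqrtOfOne m x → SqrtOfOne n x → SqrtOfOne (m * n) x
sqrtOfOne-* {m} {n} x coprime m∣ n∣ =
  coprime⇒*∣ coprime (from (∣[x²+mn∸1]⇔sqrtOfOne m n x) m∣)
                     (subst (λ k → n ∣ x * x + (k ∸ 1)) (*-comm n m) (from (∣[x²+mn∸1]⇔sqrtOfOne n m x) n∣))

sqrtOfOne-prime⇔ : ∀ {p} x → Prime p → SqrtOfOne p x ⇔ (p ∣ x + 1 ⊎ p ∣ x + (p ∸ 1))
sqrtOfOne-prime⇔ {p@(suc p′)} x p-prime = mk⇔
  (λ p∣ → euclidsLemma (x + 1) (x + p′) p-prime (subst (p ∣_) (sym factor) (∣m∣n⇒∣m+n p∣ (m∣m*n x))))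
  (λ { (inj₁ p∣x+1)  → via (∣m⇒∣m*n (x + p′) p∣x+1)
     ; (inj₂ p∣x+p′) → via (∣n⇒∣m*n (x + 1) p∣x+p′) })
  where
  factor : (x + 1) * (x + p′) ≡ (x * x + p′) + p * x
  factor = expand x p′
    where
    expand : ∀ x p′ → (x + 1) * (x + p′) ≡ (x * x + p′) + suc p′ * x
    expand = solve-∀
  via : p ∣ (x + 1) * (x + p′) → SqrtOfOne p x
  via p∣ = to (∣n⇒[∣m+n⇔∣m] (m∣m*n x)) (subst (p ∣_) factor p∣)

-- x + 1 and x + (p - 1) differ by p - 2, a non-zero number below p.
∣x+1⇒∤x+[p∸1] : ∀ {p} x → 3 ≤ p → p ∣ x + 1 → ¬ p ∣ x + (p ∸ 1)
∣x+1⇒∤x+[p∸1] {p@(suc (suc (suc k)))} x (s≤s (s≤s (s≤s _))) p∣x+1 p∣x+p∸1 =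
  contradiction (∣⇒≡0 p∣1+k (s≤s (n≤1+n (suc k)))) λ ()
  where
  p∣1+k : p ∣ suc k
  p∣1+k = ∣m+n∣m⇒∣n (subst (p ∣_) (regroup x k) p∣x+p∸1) p∣x+1
    where
    regroup : ∀ x k → x + (2 + k) ≡ (x + 1) + suc k
    regroup = solve-∀

sqrtOfOne∧∣⇒≡1 : ∀ {m} x .{{_ : NonZero m}} → SqrtOfOne m x → m ∣ x → m ≡ 1
sqrtOfOne∧∣⇒≡1 {suc m′} x m∣x²+m′ m∣x = cong suc (∣⇒≡0 (∣m+n∣m⇒∣n m∣x²+m′ (∣m⇒∣m*n x m∣x)) ≤-refl)

-- Lifting square roots of 1 from m to m * p

module _ {m p : ℕ} .{{_ : NonZero m}} (p-prime : Prime p) where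

  private instance
    p≢0 : NonZero p
    p≢0 = prime⇒nonZero p-prime
    mp≢0 : NonZero (m * p)
    mp≢0 = m*n≢0 m p

  count-lifts-nonSqrt : ∀ {y} → ¬ SqrtOfOne m y → count (λ t → sqrtOfOne? (m * p) (t * m + y)) p ≡ 0
  count-lifts-nonSqrt {y} ¬root = count-none _ p λ {t} _ root →
    ¬root (to (sqrtOfOne-periodic m t y) (sqrtOfOne-∣ (t * m + y) (m∣m*n p) root))

  -- Chinese remainder theorem: a root modulo m lifts to one root for each of the roots ±1 modulo p.
  sqrtsOfOne-*-newOddPrime : 3 ≤ p → ¬ p ∣ m → sqrtsOfOne (m * p) ≡ 2 * sqrtsOfOne m
  sqrtsOfOne-*-newOddPrime 3≤p p∤m = count-fibres (sqrtOfOne? (m * p)) (sqrtOfOne? m) m p 2 fibre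
    where
    coprime : Coprime p m
    coprime = prime∤⇒coprime p-prime p∤m
    fibre : ∀ {y} → y < m → count (λ t → sqrtOfOne? (m * p) (t * m + y)) p ≡ 2 * 𝟙 (sqrtOfOne? m y)
    fibre {y} _ with sqrtOfOne? m y
    ... | no ¬root = count-lifts-nonSqrt ¬root
    ... | yes root = begin
      count (λ t → sqrtOfOne? (m * p) (t * m + y)) p
        ≡⟨ ∑-cong p (λ {t} _ → 𝟙-⊎ (sqrtOfOne? (m * p) (t * m + y)) (p ∣? t * m + (y + 1)) (p ∣? t * m + (y + (p ∸ 1)))
                                   (lift t) (disjoint t)) ⟩
      ∑[ t < p ] (𝟙 (p ∣? t * m + (y + 1)) + 𝟙 (p ∣? t * m + (y + (p ∸ 1))))
        ≡⟨ ∑-distrib-+ p _ _ ⟩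
      count (λ t → p ∣? t * m + (y + 1)) p + count (λ t → p ∣? t * m + (y + (p ∸ 1))) p
        ≡⟨ cong₂ _+_ (linear-congruence (y + 1) coprime) (linear-congruence (y + (p ∸ 1)) coprime) ⟩
      2 ∎
      where
      open ≡-Reasoning
      reassoc : ∀ t c → p ∣ t * m + y + c ⇔ p ∣ t * m + (y + c)
      reassoc t c = subst (λ z → p ∣ t * m + y + c ⇔ p ∣ z) (+-assoc (t * m) y c) (mk⇔ id id)
      lift : ∀ t → SqrtOfOne (m * p) (t * m + y) ⇔ (p ∣ t * m + (y + 1) ⊎ p ∣ t * m + (y + (p ∸ 1)))
      lift t = mk⇔
        (λ root-mp → ⊎-map (to (reassoc t 1)) (to (reassoc t (p ∸ 1)))
                       (to (sqrtOfOne-prime⇔ _ p-prime) (sqrtOfOne-∣ (t * m + y) (n∣m*n m) root-mp)))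
        (λ root-p → sqrtOfOne-* (t * m + y) (Coprime-sym coprime) (from (sqrtOfOne-periodic m t y) root)
                       (from (sqrtOfOne-prime⇔ _ p-prime) (⊎-map (from (reassoc t 1)) (from (reassoc t (p ∸ 1))) root-p)))
      disjoint : ∀ t → ¬ (p ∣ t * m + (y + 1) × p ∣ t * m + (y + (p ∸ 1)))
      disjoint t (p∣+1 , p∣+p∸1) =
        ∣x+1⇒∤x+[p∸1] (t * m + y) 3≤p (from (reassoc t 1) p∣+1) (from (reassoc t (p ∸ 1)) p∣+p∸1)

  sqrtOfOne-lift⇔ : ∀ {y c} t → p ∣ m → y * y + (m ∸ 1) ≡ c * m →
                    SqrtOfOne (m * p) (t * m + y) ⇔ p ∣ t * (2 * y) + (c + (p ∸ 1))
  sqrtOfOne-lift⇔ {y} {c} t p∣m y²+m∸1≡cm =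
    mk⇔ (λ mp∣ → to p∣W+ttm⇔p∣W (*-cancelˡ-∣ m (subst (m * p ∣_) factor mp∣)))
        (λ p∣W → subst (m * p ∣_) (sym factor) (*-monoʳ-∣ m (from p∣W+ttm⇔p∣W p∣W)))
    where
    open ≡-Reasoning
    W = t * (2 * y) + (c + (p ∸ 1))
    p∣W+ttm⇔p∣W : p ∣ W + t * t * m ⇔ p ∣ W
    p∣W+ttm⇔p∣W = ∣n⇒[∣m+n⇔∣m] (∣n⇒∣m*n (t * t) p∣m)
    factor : (t * m + y) * (t * m + y) + (m * p ∸ 1) ≡ m * (W + t * t * m)
    factor = begin
      (t * m + y) * (t * m + y) + (m * p ∸ 1)
        ≡⟨ cong ((t * m + y) * (t * m + y) +_) (*∸1 m p) ⟩
      (t * m + y) * (t * m + y) + ((m ∸ 1) + m * (p ∸ 1))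
        ≡⟨ expand t m y (m ∸ 1) (p ∸ 1) ⟩
      (y * y + (m ∸ 1)) + m * (t * (t * m + 2 * y) + (p ∸ 1))
        ≡⟨ cong (_+ m * (t * (t * m + 2 * y) + (p ∸ 1))) y²+m∸1≡cm ⟩
      c * m + m * (t * (t * m + 2 * y) + (p ∸ 1))
        ≡⟨ collect c m t y (p ∸ 1) ⟩
      m * (W + t * t * m) ∎
      where
      expand : ∀ t m y k l → (t * m + y) * (t * m + y) + (k + m * l) ≡ (y * y + k) + m * (t * (t * m + 2 * y) + l)
      expand = solve-∀
      collect : ∀ c m t y l → c * m + m * (t * (t * m + 2 * y) + l) ≡ m * (t * (2 * y) + (c + l) + t * t * m)
      collect = solve-∀

  -- When p ∣ m, the lifts of a root y are cut out by a linear congruence in t whose coefficient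
  -- 2 * y is a unit modulo p, so each root has exactly one lift.
  sqrtsOfOne-*-oldOddPrime : 3 ≤ p → p ∣ m → sqrtsOfOne (m * p) ≡ sqrtsOfOne m
  sqrtsOfOne-*-oldOddPrime 3≤p p∣m =
    trans (count-fibres (sqrtOfOne? (m * p)) (sqrtOfOne? m) m p 1 fibre) (*-identityˡ (sqrtsOfOne m))
    where
    fibre : ∀ {y} → y < m → count (λ t → sqrtOfOne? (m * p) (t * m + y)) p ≡ 1 * 𝟙 (sqrtOfOne? m y)
    fibre {y} _ with sqrtOfOne? m y
    ... | no ¬root = count-lifts-nonSqrt ¬root
    ... | yes root@(divides c y²+m∸1≡cm) =
      trans (count-cong _ (λ t → p ∣? t * (2 * y) + (c + (p ∸ 1))) p (λ {t} _ → sqrtOfOne-lift⇔ t p∣m y²+m∸1≡cm))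
            (linear-congruence _ (prime∤⇒coprime p-prime p∤2y))
      where
      p∤2y : ¬ p ∣ 2 * y
      p∤2y p∣2y with euclidsLemma 2 y p-prime p∣2y
      ... | inj₁ p∣2 = contradiction (∣⇒≤ p∣2) (<⇒≱ 3≤p)
      ... | inj₂ p∣y = contradiction (sqrtOfOne∧∣⇒≡1 y (sqrtOfOne-∣ y p∣m root) p∣y)
                                     (>⇒≢ (<-trans (s≤s (s≤s z≤n)) 3≤p))

𝟙[2∣1+n]+𝟙[2∣n]≡1 : ∀ n → 𝟙 (2 ∣? suc n) + 𝟙 (2 ∣? n) ≡ 1
𝟙[2∣1+n]+𝟙[2∣n]≡1 zero    = refl
𝟙[2∣1+n]+𝟙[2∣n]≡1 (suc n) = begin
  𝟙 (2 ∣? suc (suc n)) + 𝟙 (2 ∣? suc n) ≡⟨ cong (_+ 𝟙 (2 ∣? suc n)) (𝟙-cong (2 ∣? _) (2 ∣? n) 2∣2+n⇔2∣n) ⟩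
  𝟙 (2 ∣? n) + 𝟙 (2 ∣? suc n)           ≡⟨ +-comm (𝟙 (2 ∣? n)) _ ⟩
  𝟙 (2 ∣? suc n) + 𝟙 (2 ∣? n)           ≡⟨ 𝟙[2∣1+n]+𝟙[2∣n]≡1 n ⟩
  1                                     ∎
  where
  open ≡-Reasoning
  2∣2+n⇔2∣n : 2 ∣ suc (suc n) ⇔ 2 ∣ n
  2∣2+n⇔2∣n = subst (λ k → 2 ∣ k ⇔ 2 ∣ n) (+-comm n 2) (∣n⇒[∣m+n⇔∣m] ∣-refl)

¬2∣⇒odd : ∀ z → ¬ 2 ∣ z → ∃[ w ] z ≡ 1 + 2 * w
¬2∣⇒odd zero          2∤0   = contradiction (divides 0 refl) 2∤0
¬2∣⇒odd (suc zero)    _     = 0 , refl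
¬2∣⇒odd (suc (suc z)) 2∤2+z with ¬2∣⇒odd z (2∤2+z ∘ ∣m∣n⇒∣m+n ∣-refl)
... | w , refl = suc w , shift w
  where
  shift : ∀ w → 2 + (1 + 2 * w) ≡ 1 + 2 * suc w
  shift = solve-∀

sqrtOfOne∧2∣⇒¬2∣ : ∀ {m} z .{{_ : NonZero m}} → 2 ∣ m → SqrtOfOne m z → ¬ 2 ∣ z
sqrtOfOne∧2∣⇒¬2∣ {suc m′} z 2∣m m∣z²+m′ 2∣z = contradiction (∣1⇒≡1 2∣1) λ ()
  where
  2∣m′ : 2 ∣ m′
  2∣m′ = ∣m+n∣m⇒∣n (∣-trans 2∣m m∣z²+m′) (∣m⇒∣m*n z 2∣z)
  2∣1 : 2 ∣ 1
  2∣1 = ∣m+n∣m⇒∣n (subst (2 ∣_) (+-comm 1 m′) 2∣m) 2∣m′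

count-sqrtOfOne-periodic : ∀ n m k → n ∣ 2 * m → n ∣ m * m → count (sqrtOfOne? n) (m * k) ≡ k * count (sqrtOfOne? n) m
count-sqrtOfOne-periodic n m k n∣2m n∣m² = count-fibres (sqrtOfOne? n) (sqrtOfOne? n) m k k fibre
  where
  fibre : ∀ {y} → y < m → count (λ t → sqrtOfOne? n (t * m + y)) k ≡ k * 𝟙 (sqrtOfOne? n y)
  fibre {y} _ = trans (∑-cong k (λ {t} _ → 𝟙-cong (sqrtOfOne? n (t * m + y)) (sqrtOfOne? n y)
                                                     (sqrtOfOne-shift m t y n∣2m n∣m²)))
                      (∑-const k _)

sqrtOfOne-*2⇔ : ∀ {m x c} .{{_ : NonZero m}} → x * x + (m ∸ 1) ≡ c * m → SqrtOfOne (m * 2) x ⇔ 2 ∣ suc c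
sqrtOfOne-*2⇔ {m} {x} {c} x²+m∸1≡cm = mk⇔ (λ 2m∣ → *-cancelˡ-∣ m (subst (m * 2 ∣_) factor 2m∣))
                                         (λ 2∣1+c → subst (m * 2 ∣_) (sym factor) (*-monoʳ-∣ m 2∣1+c))
  where
  factor : x * x + (m * 2 ∸ 1) ≡ m * suc c
  factor = begin
    x * x + (m * 2 ∸ 1)             ≡⟨ cong (x * x +_) (*∸1 m 2) ⟩
    x * x + ((m ∸ 1) + m * 1)       ≡⟨ +-assoc (x * x) (m ∸ 1) (m * 1) ⟨
    x * x + (m ∸ 1) + m * 1         ≡⟨ cong (_+ m * 1) x²+m∸1≡cm ⟩
    c * m + m * 1                   ≡⟨ cong (_+ m * 1) (*-comm c m) ⟩
    m * c + m * 1                   ≡⟨ *-distribˡ-+ m c 1 ⟨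
    m * (c + 1)                     ≡⟨ cong (m *_) (+-comm c 1) ⟩
    m * suc c                       ∎
    where open ≡-Reasoning

-- With h = 4E, (h + z)² = z² + (2E + z) * 8E, and z is odd, so the quotient changes parity.
sqrtOfOne-*2-shift⇔ : ∀ E {z c} .{{_ : NonZero E}} → z * z + (E * 8 ∸ 1) ≡ c * (E * 8) → ¬ 2 ∣ z →
                      SqrtOfOne (E * 8 * 2) (E * 4 + z) ⇔ 2 ∣ c
sqrtOfOne-*2-shift⇔ E {z} {c} z²+m∸1≡cm 2∤z with ¬2∣⇒odd z 2∤z
... | w , refl = subst (λ k → 2 ∣ k ⇔ 2 ∣ c) (regroup c E w) (∣n⇒[∣m+n⇔∣m] (m∣m*n (1 + E + w)))
                   ⇔-∘ sqrtOfOne-*2⇔ {E * 8} {E * 4 + z} {c + (2 * E + z)} {{m*n≢0 E 8}} [h+z]²+m∸1≡c′m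
  where
  regroup : ∀ c E w → c + 2 * (1 + E + w) ≡ suc (c + (2 * E + (1 + 2 * w)))
  regroup = solve-∀
  [h+z]²+m∸1≡c′m : (E * 4 + z) * (E * 4 + z) + (E * 8 ∸ 1) ≡ (c + (2 * E + z)) * (E * 8)
  [h+z]²+m∸1≡c′m = begin
    (E * 4 + z) * (E * 4 + z) + (E * 8 ∸ 1)   ≡⟨ expand E z (E * 8 ∸ 1) ⟩
    (z * z + (E * 8 ∸ 1)) + (2 * E + z) * (E * 8) ≡⟨ cong (_+ (2 * E + z) * (E * 8)) z²+m∸1≡cm ⟩
    c * (E * 8) + (2 * E + z) * (E * 8)       ≡⟨ *-distribʳ-+ (E * 8) c (2 * E + z) ⟨
    (c + (2 * E + z)) * (E * 8)               ∎
    where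
    open ≡-Reasoning
    expand : ∀ E z K → (E * 4 + z) * (E * 4 + z) + K ≡ (z * z + K) + (2 * E + z) * (E * 8)
    expand = solve-∀

-- With m = 2h: the lifts y, y + m of y < m are both or neither roots modulo 2m, the lifts z, z + h
-- of z < h are both or neither roots modulo m, and exactly one of them is a root modulo 2m.
sqrtsOfOne-[8E]*2 : ∀ E .{{_ : NonZero E}} → sqrtsOfOne (E * 8 * 2) ≡ sqrtsOfOne (E * 8)
sqrtsOfOne-[8E]*2 E = begin
  count (sqrtOfOne? (m * 2)) (m * 2)       ≡⟨ count-sqrtOfOne-periodic (m * 2) m 2 (∣-reflexive (*-comm m 2)) (*-monoʳ-∣ m 2∣m) ⟩
  2 * count (sqrtOfOne? (m * 2)) m         ≡⟨ cong (λ k → 2 * count (sqrtOfOne? (m * 2)) k) m≡h*2 ⟩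
  2 * count (sqrtOfOne? (m * 2)) (h * 2)   ≡⟨ cong (2 *_) (count-fibres (sqrtOfOne? (m * 2)) (sqrtOfOne? m) h 2 1 fibre) ⟩
  2 * (1 * count (sqrtOfOne? m) h)         ≡⟨ cong (2 *_) (*-identityˡ (count (sqrtOfOne? m) h)) ⟩
  2 * count (sqrtOfOne? m) h               ≡⟨ count-sqrtOfOne-periodic m h 2 m∣2h m∣h² ⟨
  count (sqrtOfOne? m) (h * 2)             ≡⟨ cong (count (sqrtOfOne? m)) m≡h*2 ⟨
  count (sqrtOfOne? m) m                   ∎
  where
  open ≡-Reasoning
  m = E * 8
  h = E * 4
  instance
    m≢0 : NonZero m
    m≢0 = m*n≢0 E 8
    2m≢0 : NonZero (m * 2)
    2m≢0 = m*n≢0 m 2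
  m≡h*2 : m ≡ h * 2
  m≡h*2 = regroup E
    where
    regroup : ∀ E → E * 8 ≡ E * 4 * 2
    regroup = solve-∀
  2∣m : 2 ∣ m
  2∣m = divides h m≡h*2
  m∣2h : m ∣ 2 * h
  m∣2h = ∣-reflexive (trans m≡h*2 (*-comm h 2))
  m∣h² : m ∣ h * h
  m∣h² = divides (2 * E) (regroup E)
    where
    regroup : ∀ E → E * 4 * (E * 4) ≡ 2 * E * (E * 8)
    regroup = solve-∀
  fibre : ∀ {z} → z < h → count (λ t → sqrtOfOne? (m * 2) (t * h + z)) 2 ≡ 1 * 𝟙 (sqrtOfOne? m z)
  fibre {z} _ with sqrtOfOne? m z
  ... | no ¬root = count-none (λ t → sqrtOfOne? (m * 2) (t * h + z)) 2 λ {t} _ root →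
        ¬root (to (sqrtOfOne-shift h t z m∣2h m∣h²) (sqrtOfOne-∣ (t * h + z) (m∣m*n 2) root))
  ... | yes root@(divides c z²+m∸1≡cm) = begin
    𝟙 (sqrtOfOne? (m * 2) z) + 𝟙 (sqrtOfOne? (m * 2) (1 * h + z))
      ≡⟨ cong₂ _+_ (𝟙-cong (sqrtOfOne? (m * 2) z) (2 ∣? suc c) (sqrtOfOne-*2⇔ {m} {z} {c} z²+m∸1≡cm))
                   (𝟙-cong (sqrtOfOne? (m * 2) (1 * h + z)) (2 ∣? c) root[h+z]⇔2∣c) ⟩
    𝟙 (2 ∣? suc c) + 𝟙 (2 ∣? c)
      ≡⟨ 𝟙[2∣1+n]+𝟙[2∣n]≡1 c ⟩
    1 ∎
    where
    root[h+z]⇔2∣c : SqrtOfOne (m * 2) (1 * h + z) ⇔ 2 ∣ c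
    root[h+z]⇔2∣c = subst (λ x → SqrtOfOne (m * 2) (x + z) ⇔ 2 ∣ c) (sym (*-identityˡ h))
                          (sqrtOfOne-*2-shift⇔ E z²+m∸1≡cm (sqrtOfOne∧2∣⇒¬2∣ z 2∣m root))

sqrtsOfOne-*-2 : ∀ {m} → 8 ∣ m → sqrtsOfOne (m * 2) ≡ sqrtsOfOne m
sqrtsOfOne-*-2 (divides zero      refl) = refl
sqrtsOfOne-*-2 (divides (suc E′) refl) = sqrtsOfOne-[8E]*2 (suc E′)

sqrtsOfOne-*-oldPrime : ∀ {m q} .{{_ : NonZero m}} → 8 ∣ m → Prime q → q ∣ m → sqrtsOfOne (m * q) ≡ sqrtsOfOne m
sqrtsOfOne-*-oldPrime {q = 2}                   8∣m _       _   = sqrtsOfOne-*-2 8∣m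
sqrtsOfOne-*-oldPrime {q = suc (suc (suc _))} 8∣m q-prime q∣m = sqrtsOfOne-*-oldOddPrime q-prime (s≤s (s≤s (s≤s z≤n))) q∣m

sqrtsOfOne-*-product : ∀ {m} qs .{{_ : NonZero m}} → 8 ∣ m → All Prime qs → (∀ {q} → q ∈ qs → q ∣ m) →
                       sqrtsOfOne (m * product qs) ≡ sqrtsOfOne m
sqrtsOfOne-*-product {m} []       8∣m []                   _    = cong sqrtsOfOne (*-identityʳ m)
sqrtsOfOne-*-product {m} (q ∷ qs) 8∣m (q-prime ∷ qs-prime) qs∣m = begin
  sqrtsOfOne (m * (q * product qs))  ≡⟨ cong sqrtsOfOne (*-assoc m q (product qs)) ⟨
  sqrtsOfOne (m * q * product qs)    ≡⟨ sqrtsOfOne-*-product qs (∣m⇒∣m*n q 8∣m) qs-prime (∣m⇒∣m*n q ∘ qs∣m ∘ there) ⟩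
  sqrtsOfOne (m * q)                 ≡⟨ sqrtsOfOne-*-oldPrime 8∣m q-prime (qs∣m (here refl)) ⟩
  sqrtsOfOne m                       ∎
  where
  open ≡-Reasoning
  instance
    mq≢0 : NonZero (m * q)
    mq≢0 = m*n≢0 m q {{it}} {{prime⇒nonZero q-prime}}

sqrtsOfOne-*-oldPrimes : ∀ {m} d .{{_ : NonZero m}} .{{_ : NonZero d}} → 8 ∣ m →
                         (∀ {q} → Prime q → q ∣ d → q ∣ m) → sqrtsOfOne (m * d) ≡ sqrtsOfOne m
sqrtsOfOne-*-oldPrimes {m} d 8∣m primes∣m =
  trans (cong (λ k → sqrtsOfOne (m * k)) isFactorisation)
        (sqrtsOfOne-*-product factors 8∣m factorsPrime λ q∈ → primes∣m (lookup factorsPrime q∈)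
                                                                        (subst (_ ∣_) (sym isFactorisation) (∈⇒∣product q∈)))
  where open PrimeFactorisation (factorise d)

-- Square roots of 1 modulo 4 * a!

π : ℕ → ℕ
π n = count prime? (suc n)

prime∣n!⇒≤ : ∀ {p} n → Prime p → p ∣ n ! → p ≤ n
prime∣n!⇒≤ zero    p-prime p∣1 = contradiction (subst Prime (∣1⇒≡1 p∣1) p-prime) ¬prime[1]
prime∣n!⇒≤ (suc n) p-prime p∣n! with euclidsLemma (suc n) (n !) p-prime p∣n!
... | inj₁ p∣1+n = ∣⇒≤ p∣1+n
... | inj₂ p∣n!  = m≤n⇒m≤1+n (prime∣n!⇒≤ n p-prime p∣n!)

≤⇒∣! : ∀ {m n} → .{{NonZero m}} → m ≤ n → m ∣ n !
≤⇒∣! {suc m} m≤n = ∣-trans (m∣m*n (m !)) (m≤n⇒m!∣n! m≤n)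

prime>n⇒∤4*n! : ∀ {p} n → Prime p → 2 < p → n < p → ¬ p ∣ 4 * n !
prime>n⇒∤4*n! n p-prime 2<p n<p p∣4n! with euclidsLemma 4 (n !) p-prime p∣4n!
... | inj₂ p∣n! = <⇒≱ n<p (prime∣n!⇒≤ n p-prime p∣n!)
... | inj₁ p∣4 with euclidsLemma 2 2 p-prime p∣4
...   | inj₁ p∣2 = <⇒≱ 2<p (∣⇒≤ p∣2)
...   | inj₂ p∣2 = <⇒≱ 2<p (∣⇒≤ p∣2)

sqrtsOfOne[4*a!]≡2^[1+πa] : ∀ a → sqrtsOfOne (4 * a !) ≡ 2 ^ suc (π a)
sqrtsOfOne[4*a!]≡2^[1+πa] 0 = refl
sqrtsOfOne[4*a!]≡2^[1+πa] 1 = refl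
sqrtsOfOne[4*a!]≡2^[1+πa] 2 = refl
sqrtsOfOne[4*a!]≡2^[1+πa] (suc a@(suc (suc _))) = begin
  sqrtsOfOne (4 * suc a !)      ≡⟨ cong sqrtsOfOne (regroup (a !) a) ⟩
  sqrtsOfOne (m * suc a)        ≡⟨ step (sqrtsOfOne[4*a!]≡2^[1+πa] a) (prime? (suc a)) ⟩
  2 ^ suc (π (suc a))           ∎
  where
  open ≡-Reasoning
  regroup : ∀ f a → 4 * (suc a * f) ≡ 4 * f * suc a
  regroup = solve-∀
  m = 4 * a !
  instance
    m≢0 : NonZero m
    m≢0 = 4a!-nonZero a
  step : sqrtsOfOne m ≡ 2 ^ suc (π a) → (1+a-prime? : Dec (Prime (suc a))) →
         sqrtsOfOne (m * suc a) ≡ 2 ^ suc (π a + 𝟙 1+a-prime?)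
  step ih (yes 1+a-prime) = begin
    sqrtsOfOne (m * suc a)       ≡⟨ sqrtsOfOne-*-newOddPrime 1+a-prime 3≤1+a (prime>n⇒∤4*n! a 1+a-prime 3≤1+a ≤-refl) ⟩
    2 * sqrtsOfOne m             ≡⟨ cong (2 *_) ih ⟩
    2 ^ suc (suc (π a))          ≡⟨ cong (λ k → 2 ^ suc k) (+-comm 1 (π a)) ⟩
    2 ^ suc (π a + 1)            ∎
    where
    3≤1+a : 3 ≤ suc a
    3≤1+a = s≤s (s≤s (s≤s z≤n))
  step ih (no 1+a-composite) = begin
    sqrtsOfOne (m * suc a)       ≡⟨ sqrtsOfOne-*-oldPrimes (suc a) (*-monoʳ-∣ 4 (≤⇒∣! {2} {a} (s≤s (s≤s z≤n)))) primes∣m ⟩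
    sqrtsOfOne m                 ≡⟨ ih ⟩
    2 ^ suc (π a)                ≡⟨ cong (λ k → 2 ^ suc k) (+-identityʳ (π a)) ⟨
    2 ^ suc (π a + 0)            ∎
    where
    primes∣m : ∀ {q} → Prime q → q ∣ suc a → q ∣ m
    primes∣m {q} q-prime q∣1+a = ∣n⇒∣m*n 4 (≤⇒∣! {{prime⇒nonZero q-prime}} q≤a)
      where
      q≤a : q ≤ a
      q≤a = s≤s⁻¹ (≤∧≢⇒< (∣⇒≤ q∣1+a) λ { refl → 1+a-composite q-prime })

-- Legendre's formula

[r+q*d]/d≡q : ∀ {r d} q .{{_ : NonZero d}} → r < d → (r + q * d) / d ≡ q
[r+q*d]/d≡q {r} {d} q r<d = begin
  (r + q * d) / d      ≡⟨ +-distrib-/-∣ʳ r (n∣m*n q) ⟩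
  r / d + q * d / d    ≡⟨ cong₂ _+_ (m<n⇒m/n≡0 r<d) (m*n/n≡m q d) ⟩
  q                    ∎
  where open ≡-Reasoning

/-suc : ∀ N d .{{_ : NonZero d}} → suc N / d ≡ N / d + 𝟙 (d ∣? suc N)
/-suc N d with m≤n⇒m<n∨m≡n (m%n<n N d)
... | inj₁ 1+r<d = begin
  suc N / d                          ≡⟨ cong (_/ d) 1+N≡1+r+qd ⟩
  (suc (N % d) + N / d * d) / d      ≡⟨ [r+q*d]/d≡q (N / d) 1+r<d ⟩
  N / d                              ≡⟨ +-identityʳ (N / d) ⟨
  N / d + 0                          ≡⟨ cong (N / d +_) (𝟙-no (d ∣? suc N) d∤1+N) ⟨
  N / d + 𝟙 (d ∣? suc N)             ∎
  where
  open ≡-Reasoning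
  1+N≡1+r+qd : suc N ≡ suc (N % d) + N / d * d
  1+N≡1+r+qd = cong suc (m≡m%n+[m/n]*n N d)
  d∤1+N : ¬ d ∣ suc N
  d∤1+N d∣1+N = contradiction (∣⇒≡0 d∣1+r 1+r<d) λ ()
    where
    d∣1+r : d ∣ suc (N % d)
    d∣1+r = to (∣n⇒[∣m+n⇔∣m] (n∣m*n (N / d))) (subst (d ∣_) 1+N≡1+r+qd d∣1+N)
... | inj₂ 1+r≡d = begin
  suc N / d                          ≡⟨ cong (_/ d) 1+N≡[1+q]d ⟩
  suc (N / d) * d / d                ≡⟨ m*n/n≡m (suc (N / d)) d ⟩
  suc (N / d)                        ≡⟨ +-comm 1 (N / d) ⟩
  N / d + 1                          ≡⟨ cong (N / d +_) (𝟙-yes (d ∣? suc N) (divides (suc (N / d)) 1+N≡[1+q]d)) ⟨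
  N / d + 𝟙 (d ∣? suc N)             ∎
  where
  open ≡-Reasoning
  1+N≡[1+q]d : suc N ≡ suc (N / d) * d
  1+N≡[1+q]d = trans (cong suc (m≡m%n+[m/n]*n N d)) (cong (_+ N / d * d) 1+r≡d)

[m+m]/d≤2[m/d]+𝟙[d≤m+m] : ∀ m d .{{_ : NonZero d}} → (m + m) / d ≤ 2 * (m / d) + 𝟙 (d ≤? m + m)
[m+m]/d≤2[m/d]+𝟙[d≤m+m] m d with d ≤? m + m
... | no  d≰2m = subst (_≤ 2 * (m / d) + 0) (sym (m<n⇒m/n≡0 (≰⇒> d≰2m))) z≤n
... | yes _    = subst ((m + m) / d ≤_) (+-comm 1 (2 * (m / d))) (s≤s⁻¹ (m<n*o⇒m/o<n 2m<[2q+2]d))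
  where
  open ≤-Reasoning
  m<[q+1]d : m < (m / d + 1) * d
  m<[q+1]d = begin-strict
    m                      ≡⟨ m≡m%n+[m/n]*n m d ⟩
    m % d + m / d * d      <⟨ +-monoˡ-< (m / d * d) (m%n<n m d) ⟩
    d + m / d * d          ≡⟨ cong (_+ m / d * d) (*-identityˡ d) ⟨
    1 * d + m / d * d      ≡⟨ *-distribʳ-+ d 1 (m / d) ⟨
    (1 + m / d) * d        ≡⟨ cong (_* d) (+-comm 1 (m / d)) ⟩
    (m / d + 1) * d        ∎
  2m<[2q+2]d : m + m < suc (suc (2 * (m / d))) * d
  2m<[2q+2]d = begin-strict
    m + m                              <⟨ +-mono-< m<[q+1]d m<[q+1]d ⟩
    (m / d + 1) * d + (m / d + 1) * d  ≡⟨ regroup (m / d) d ⟩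
    suc (suc (2 * (m / d))) * d        ∎
    where
    regroup : ∀ q d → (q + 1) * d + (q + 1) * d ≡ suc (suc (2 * q)) * d
    regroup = solve-∀

[2m]Cm*m!²≡[2m]! : ∀ m → ((m + m) C m) * (m ! * m !) ≡ (m + m) !
[2m]Cm*m!²≡[2m]! m = begin
  ((m + m) C m) * (m ! * m !)                ≡⟨ cong (λ k → ((m + m) C m) * (m ! * k !)) (m+n∸m≡n m m) ⟨
  ((m + m) C m) * (m ! * (m + m ∸ m) !)      ≡⟨ trans (cong (_* (m ! * (m + m ∸ m) !)) (nCk≡n!/k![n-k]! m≤2m))
                                                    (m/n*n≡m {{m !* (m + m ∸ m) !≢0}} (k![n∸k]!∣n! m≤2m)) ⟩
  (m + m) !                                ∎
  where
  open ≡-Reasoning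
  m≤2m : m ≤ m + m
  m≤2m = m≤m+n m m

infix 4 _^_∥_
record _^_∥_ (p k x : ℕ) : Set where
  constructor exact
  field
    pᵏ∣x   : p ^ k ∣ x
    p¹⁺ᵏ∤x : ¬ p ^ suc k ∣ x

^-monoʳ-∣ : ∀ p {a b} → a ≤ b → p ^ a ∣ p ^ b
^-monoʳ-∣ p {a} {b} a≤b = divides (p ^ (b ∸ a)) (begin
  p ^ b                  ≡⟨ cong (p ^_) (m+[n∸m]≡n a≤b) ⟨
  p ^ (a + (b ∸ a))      ≡⟨ ^-distribˡ-+-* p a (b ∸ a) ⟩
  p ^ a * p ^ (b ∸ a)    ≡⟨ *-comm (p ^ a) _ ⟩
  p ^ (b ∸ a) * p ^ a    ∎)
  where open ≡-Reasoning

∣∧∥⇒≤ : ∀ {p a b x} .{{_ : NonZero p}} → p ^ a ∣ x → p ^ b ∥ x → a ≤ b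
∣∧∥⇒≤ {p} {a} {b} pᵃ∣x (exact _ p¹⁺ᵇ∤x) with a ≤? b
... | yes a≤b = a≤b
... | no  a≰b = contradiction (∣-trans (^-monoʳ-∣ p (≰⇒> a≰b)) pᵃ∣x) p¹⁺ᵇ∤x

∥-* : ∀ {p a b x y} → Prime p → p ^ a ∥ x → p ^ b ∥ y → p ^ (a + b) ∥ x * y
∥-* {p} {a} {b} p-prime (exact pᵃ∣x@(divides x′ refl) p¹⁺ᵃ∤x) (exact pᵇ∣y@(divides y′ refl) p¹⁺ᵇ∤y) =
  exact (subst (_∣ x′ * p ^ a * (y′ * p ^ b)) (sym (^-distribˡ-+-* p a b)) (*-pres-∣ pᵃ∣x pᵇ∣y)) p¹⁺ᵃ⁺ᵇ∤xy
  where
  instance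
    pᵃ⁺ᵇ≢0 : NonZero (p ^ (a + b))
    pᵃ⁺ᵇ≢0 = m^n≢0 p (a + b) {{prime⇒nonZero p-prime}}
  xy≡x′y′pᵃ⁺ᵇ : x′ * p ^ a * (y′ * p ^ b) ≡ x′ * y′ * p ^ (a + b)
  xy≡x′y′pᵃ⁺ᵇ = trans (regroup x′ y′ (p ^ a) (p ^ b)) (cong (x′ * y′ *_) (sym (^-distribˡ-+-* p a b)))
    where
    regroup : ∀ x′ y′ A B → x′ * A * (y′ * B) ≡ x′ * y′ * (A * B)
    regroup = solve-∀
  p¹⁺ᵃ⁺ᵇ∤xy : ¬ p ^ suc (a + b) ∣ x′ * p ^ a * (y′ * p ^ b)
  p¹⁺ᵃ⁺ᵇ∤xy p¹⁺ᵃ⁺ᵇ∣xy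
    with euclidsLemma x′ y′ p-prime (*-cancelʳ-∣ (p ^ (a + b)) (subst (p * p ^ (a + b) ∣_) xy≡x′y′pᵃ⁺ᵇ p¹⁺ᵃ⁺ᵇ∣xy))
  ... | inj₁ p∣x′ = p¹⁺ᵃ∤x (*-monoˡ-∣ (p ^ a) p∣x′)
  ... | inj₂ p∣y′ = p¹⁺ᵇ∤y (*-monoˡ-∣ (p ^ b) p∣y′)

module _ {p : ℕ} (p-prime : Prime p) where

  private instance
    p≢0 : NonZero p
    p≢0 = prime⇒nonZero p-prime

  valuation : ℕ → ℕ → ℕ
  valuation K x = count (λ i → p ^ suc i ∣? x) K

  valuation-∥ : ∀ K x → ¬ p ^ suc K ∣ x → p ^ valuation K x ∥ x
  valuation-∥ zero    x p∤x = exact (1∣ x) p∤x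
  valuation-∥ (suc K) x p²⁺ᴷ∤x = step (p ^ suc K ∣? x)
    where
    step : (p¹⁺ᴷ∣?x : Dec (p ^ suc K ∣ x)) → p ^ (valuation K x + 𝟙 p¹⁺ᴷ∣?x) ∥ x
    step (yes p¹⁺ᴷ∣x) = subst (λ k → p ^ k ∥ x) (sym valuation≡1+K) (exact p¹⁺ᴷ∣x p²⁺ᴷ∤x)
      where
      valuation≡1+K : valuation K x + 1 ≡ suc K
      valuation≡1+K = trans (cong (_+ 1) (count-all _ K (λ i<K → ∣-trans (^-monoʳ-∣ p (m≤n⇒m≤1+n i<K)) p¹⁺ᴷ∣x)))
                            (+-comm K 1)
    step (no p¹⁺ᴷ∤x) = subst (λ k → p ^ k ∥ x) (sym (+-identityʳ _)) (valuation-∥ K x p¹⁺ᴷ∤x)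

  legendreSum : ℕ → ℕ → ℕ
  legendreSum K N = ∑[ i < K ] (N / p ^ suc i) {{m^n≢0 p (suc i)}}

  legendre : ∀ K N → N < p ^ suc K → p ^ legendreSum K N ∥ N !
  legendre K zero    _ = subst (λ k → p ^ k ∥ 1) (sym L[0]≡0) (exact ∣-refl p∤1)
    where
    L[0]≡0 : legendreSum K 0 ≡ 0
    L[0]≡0 = trans (∑-cong K (λ {i} _ → 0/n≡0 (p ^ suc i) {{m^n≢0 p (suc i)}})) (∑-zero K)
    p∤1 : ¬ p * 1 ∣ 1
    p∤1 p∣1 = nonTrivial⇒≢1 {{prime⇒nonTrivial p-prime}} (trans (sym (*-identityʳ p)) (∣1⇒≡1 p∣1))
  legendre K (suc N) 1+N<p¹⁺ᴷ = subst (λ k → p ^ k ∥ suc N !) (sym L[1+N]≡v+L[N])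
                                  (∥-* p-prime (valuation-∥ K (suc N) (λ h → <⇒≱ 1+N<p¹⁺ᴷ (∣⇒≤ h)))
                                               (legendre K N (<-trans (n<1+n N) 1+N<p¹⁺ᴷ)))
    where
    open ≡-Reasoning
    L[1+N]≡v+L[N] : legendreSum K (suc N) ≡ valuation K (suc N) + legendreSum K N
    L[1+N]≡v+L[N] = begin
      legendreSum K (suc N)                                          ≡⟨ ∑-cong K (λ {i} _ → /-suc N (p ^ suc i) {{m^n≢0 p (suc i)}}) ⟩
      ∑[ i < K ] ((N / p ^ suc i) {{m^n≢0 p (suc i)}} + 𝟙 (p ^ suc i ∣? suc N)) ≡⟨ ∑-distrib-+ K _ _ ⟩
      legendreSum K N + valuation K (suc N)                          ≡⟨ +-comm (legendreSum K N) (valuation K (suc N)) ⟩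
      valuation K (suc N) + legendreSum K N                          ∎

  -- min K ⌊log_p M⌋
  powersUpTo : ℕ → ℕ → ℕ
  powersUpTo K M = count (λ i → p ^ suc i ≤? M) K

  p^powersUpTo≤ : ∀ K {M} → 1 ≤ M → p ^ powersUpTo K M ≤ M
  p^powersUpTo≤ zero    1≤M = 1≤M
  p^powersUpTo≤ (suc K) {M} 1≤M = step (p ^ suc K ≤? M)
    where
    step : (p¹⁺ᴷ≤?M : Dec (p ^ suc K ≤ M)) → p ^ (powersUpTo K M + 𝟙 p¹⁺ᴷ≤?M) ≤ M
    step (yes p¹⁺ᴷ≤M) = ≤-trans (^-monoʳ-≤ p (subst (_≤ suc K) (+-comm 1 _) (s≤s (count-≤ _ K)))) p¹⁺ᴷ≤M
    step (no _)       = subst (λ k → p ^ k ≤ M) (sym (+-identityʳ (powersUpTo K M))) (p^powersUpTo≤ K 1≤M)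

  legendreSum-double : ∀ K m → legendreSum K (m + m) ≤ 2 * legendreSum K m + powersUpTo K (m + m)
  legendreSum-double K m = begin
    legendreSum K (m + m)
      ≤⟨ ∑-mono-≤ K (λ {i} _ → [m+m]/d≤2[m/d]+𝟙[d≤m+m] m (p ^ suc i) {{m^n≢0 p (suc i)}}) ⟩
    ∑[ i < K ] (2 * (m / p ^ suc i) {{m^n≢0 p (suc i)}} + 𝟙 (p ^ suc i ≤? m + m))
      ≡⟨ ∑-distrib-+ K _ _ ⟩
    ∑[ i < K ] (2 * (m / p ^ suc i) {{m^n≢0 p (suc i)}}) + powersUpTo K (m + m)
      ≡⟨ cong (_+ powersUpTo K (m + m)) (∑-distribˡ-* K 2 _) ⟩
    2 * legendreSum K m + powersUpTo K (m + m) ∎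
    where open ≤-Reasoning

  n<p^n : ∀ n → n < p ^ n
  n<p^n zero    = s≤s z≤n
  n<p^n (suc n) = begin-strict
    suc n          ≤⟨ n<p^n n ⟩
    p ^ n          <⟨ m<m*n (p ^ n) p {{m^n≢0 p n}} (nonTrivial⇒n>1 p {{prime⇒nonTrivial p-prime}}) ⟩
    p ^ n * p      ≡⟨ *-comm (p ^ n) p ⟩
    p ^ suc n      ∎
    where open ≤-Reasoning

  -- v_p (2m choose m) = ∑ᵢ (⌊2m / pⁱ⁺¹⌋ - 2 ⌊m / pⁱ⁺¹⌋), whose terms are 0 or 1, and 0 once pⁱ⁺¹ > 2m.
  pᵏ∣[2m]Cm⇒pᵏ≤2m : ∀ {m k} → 1 ≤ m → p ^ k ∣ (m + m) C m → p ^ k ≤ m + m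
  pᵏ∣[2m]Cm⇒pᵏ≤2m {m} {k} 1≤m pᵏ∣C =
    ≤-trans (^-monoʳ-≤ p k≤powers) (p^powersUpTo≤ K (≤-trans 1≤m (m≤m+n m m)))
    where
    K = m + m
    Lₘ = legendreSum K m
    2m<p¹⁺ᴷ : m + m < p ^ suc K
    2m<p¹⁺ᴷ = <-≤-trans (n<p^n K) (^-monoʳ-≤ p (n≤1+n K))
    pᵏ⁺²ᴸ∣[2m]! : p ^ (k + (Lₘ + Lₘ)) ∣ (m + m) !
    pᵏ⁺²ᴸ∣[2m]! = subst₂ _∣_ (sym (trans (^-distribˡ-+-* p k (Lₘ + Lₘ)) (cong (p ^ k *_) (^-distribˡ-+-* p Lₘ Lₘ))))
                            ([2m]Cm*m!²≡[2m]! m) (*-pres-∣ pᵏ∣C (*-pres-∣ pᴸ∣m! pᴸ∣m!))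
      where
      pᴸ∣m! : p ^ Lₘ ∣ m !
      pᴸ∣m! = _^_∥_.pᵏ∣x (legendre K m (≤-<-trans (m≤m+n m m) 2m<p¹⁺ᴷ))
    k≤powers : k ≤ powersUpTo K (m + m)
    k≤powers = +-cancelˡ-≤ (Lₘ + Lₘ) k _ (begin
      Lₘ + Lₘ + k                           ≡⟨ +-comm (Lₘ + Lₘ) k ⟩
      k + (Lₘ + Lₘ)                         ≤⟨ ∣∧∥⇒≤ pᵏ⁺²ᴸ∣[2m]! (legendre K (m + m) 2m<p¹⁺ᴷ) ⟩
      legendreSum K (m + m)                 ≤⟨ legendreSum-double K m ⟩
      2 * Lₘ + powersUpTo K (m + m)         ≡⟨ cong (λ l → l + powersUpTo K (m + m)) (cong (Lₘ +_) (+-identityʳ Lₘ)) ⟩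
      Lₘ + Lₘ + powersUpTo K (m + m)        ∎)
      where open ≤-Reasoning

-- Chebyshev's bound and p(n) ≤ n² + 1

prime⇒2≤ : ∀ {p} → Prime p → 2 ≤ p
prime⇒2≤ {p} p-prime = nonTrivial⇒n>1 p {{prime⇒nonTrivial p-prime}}

∃prime∣ : ∀ {x} → 2 ≤ x → ∃[ p ] Prime p × p ∣ x
∃prime∣ {x} 2≤x with factorise x {{>-nonZero (<-trans (s≤s z≤n) 2≤x)}}
... | record { factors = [] ; isFactorisation = x≡1 } = contradiction x≡1 (>⇒≢ 2≤x)
... | record { factors = p ∷ ps ; isFactorisation = x≡p*Πps ; factorsPrime = p-prime ∷ _ } =
  p , p-prime , subst (p ∣_) (sym x≡p*Πps) (m∣m*n (product ps))

prime-power-split : ∀ {p} x .{{_ : NonZero x}} → 1 < p → ∃[ k ] ∃[ y ] x ≡ p ^ k * y × ¬ p ∣ y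
prime-power-split {p} x 1<p = go x (<-wellFounded x)
  where
  go : ∀ x .{{_ : NonZero x}} → Acc _<_ x → ∃[ k ] ∃[ y ] x ≡ p ^ k * y × ¬ p ∣ y
  go x (acc rec) with p ∣? x
  ... | no  p∤x = 0 , x , sym (+-identityʳ x) , p∤x
  ... | yes (divides q refl) with go q {{m*n≢0⇒m≢0 q}} (rec (m<m*n q p {{m*n≢0⇒m≢0 q}} 1<p))
  ...   | k , y , refl , p∤y = suc k , y , regroup (p ^ k) y p , p∤y
    where
    regroup : ∀ a y p → a * y * p ≡ p * a * y
    regroup = solve-∀

-- x is the product of its q-parts over the primes q ≤ N, each a prime power dividing x.
≤^π : ∀ N {x M} .{{_ : NonZero x}} → (∀ {q} → Prime q → q ∣ x → q ≤ N) →
      (∀ {q} k → Prime q → q ^ k ∣ x → q ^ k ≤ M) → x ≤ M ^ π N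
≤^π zero {suc zero}     _        _           = ≤-refl
≤^π zero {suc (suc x)}  factors≤ _ with ∃prime∣ {suc (suc x)} (s≤s (s≤s z≤n))
... | q , q-prime , q∣x = contradiction (factors≤ q-prime q∣x) (<⇒≱ (<-trans (s≤s z≤n) (prime⇒2≤ q-prime)))
≤^π (suc N) {x} {M} factors≤ powers≤ = step (prime? (suc N))
  where
  factors≤N : ∀ {y} → (∀ {q} → q ∣ y → q ∣ x) → (∀ {q} → Prime q → q ∣ y → q ≢ suc N) →
              ∀ {q} → Prime q → q ∣ y → q ≤ N
  factors≤N y∣⇒x∣ ≢1+N q-prime q∣y = s≤s⁻¹ (≤∧≢⇒< (factors≤ q-prime (y∣⇒x∣ q∣y)) (≢1+N q-prime q∣y))
  step : (1+N-prime? : Dec (Prime (suc N))) → x ≤ M ^ (π N + 𝟙 1+N-prime?)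
  step (no 1+N-composite) = subst (λ k → x ≤ M ^ k) (sym (+-identityʳ (π N)))
    (≤^π N (factors≤N (λ q∣x → q∣x) λ { q-prime _ refl → 1+N-composite q-prime }) powers≤)
  step (yes 1+N-prime) with prime-power-split {suc N} x (prime⇒2≤ 1+N-prime)
  ... | k , y , x≡[1+N]ᵏy , 1+N∤y = begin
    x                           ≡⟨ x≡[1+N]ᵏy ⟩
    suc N ^ k * y               ≤⟨ *-mono-≤ (powers≤ k 1+N-prime (subst (suc N ^ k ∣_) (sym x≡[1+N]ᵏy) (m∣m*n y)))
                                            (≤^π N {{y≢0}} (factors≤N y∣⇒x∣ λ { _ q∣y refl → 1+N∤y q∣y })
                                                           (λ j q-prime qʲ∣y → powers≤ j q-prime (y∣⇒x∣ qʲ∣y))) ⟩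
    M * M ^ π N                 ≡⟨ cong (M ^_) (+-comm 1 (π N)) ⟩
    M ^ (π N + 1)               ∎
    where
    open ≤-Reasoning
    y∣⇒x∣ : ∀ {q} → q ∣ y → q ∣ x
    y∣⇒x∣ {q} q∣y = subst (q ∣_) (sym x≡[1+N]ᵏy) (∣n⇒∣m*n (suc N ^ k) q∣y)
    y≢0 : NonZero y
    y≢0 = m*n≢0⇒n≢0 (suc N ^ k) {{subst NonZero x≡[1+N]ᵏy it}}

2^m*m!²≤[2m]! : ∀ m → 2 ^ m * (m ! * m !) ≤ (m + m) !
2^m*m!²≤[2m]! zero    = ≤-refl
2^m*m!²≤[2m]! (suc m) = begin
  2 ^ suc m * (suc m ! * suc m !)                   ≡⟨ regroup (2 ^ m) m (m !) ⟩
  (2 * suc m * suc m) * (2 ^ m * (m ! * m !))       ≤⟨ *-mono-≤ 2[1+m]²≤[2+2m][1+2m] (2^m*m!²≤[2m]! m) ⟩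
  (2 + (m + m)) * (1 + (m + m)) * (m + m) !         ≡⟨ *-assoc (2 + (m + m)) (1 + (m + m)) ((m + m) !) ⟩
  (2 + (m + m)) !                                   ≡⟨ cong (λ k → suc k !) (+-suc m m) ⟨
  (suc m + suc m) !                                 ∎
  where
  open ≤-Reasoning
  regroup : ∀ a m f → 2 * a * (suc m * f * (suc m * f)) ≡ (2 * suc m * suc m) * (a * (f * f))
  regroup = solve-∀
  2[1+m]²≤[2+2m][1+2m] : 2 * suc m * suc m ≤ (2 + (m + m)) * (1 + (m + m))
  2[1+m]²≤[2+2m][1+2m] = ≤-trans (m≤m+n _ (2 * suc m * m)) (≤-reflexive (expand m))
    where
    expand : ∀ m → 2 * suc m * suc m + 2 * suc m * m ≡ (2 + (m + m)) * (1 + (m + m))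
    expand = solve-∀

2^m≤[2m]Cm : ∀ m → 2 ^ m ≤ (m + m) C m
2^m≤[2m]Cm m = *-cancelʳ-≤ (2 ^ m) ((m + m) C m) (m ! * m !) {{m !* m !≢0}}
                 (≤-trans (2^m*m!²≤[2m]! m) (≤-reflexive (sym ([2m]Cm*m!²≡[2m]! m))))

chebyshev : ∀ {m} → 1 ≤ m → 2 ^ m ≤ (m + m) ^ π (m + m)
chebyshev {m} 1≤m = ≤-trans (2^m≤[2m]Cm m) (≤^π (m + m) {{B≢0}} factors≤ powers≤)
  where
  B = (m + m) C m
  B≢0 : NonZero B
  B≢0 = >-nonZero (≤-trans (^-monoʳ-≤ 2 {0} {m} z≤n) (2^m≤[2m]Cm m))
  powers≤ : ∀ {q} k → Prime q → q ^ k ∣ B → q ^ k ≤ m + m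
  powers≤ k q-prime qᵏ∣B = pᵏ∣[2m]Cm⇒pᵏ≤2m q-prime {k = k} 1≤m qᵏ∣B
  factors≤ : ∀ {q} → Prime q → q ∣ B → q ≤ m + m
  factors≤ {q} q-prime q∣B = subst (_≤ m + m) (*-identityʳ q) (powers≤ 1 q-prime (subst (_∣ B) (sym (*-identityʳ q)) q∣B))

π-mono-≤ : ∀ {a b} → a ≤ b → π a ≤ π b
π-mono-≤ a≤b = count-mono-≤ prime? (s≤s a≤b)

n⁴≤2ⁿ : ∀ n → 16 ≤ n → n * n * (n * n) ≤ 2 ^ n
n⁴≤2ⁿ n 16≤n = subst (λ n → n * n * (n * n) ≤ 2 ^ n) (m+[n∸m]≡n 16≤n) (go (n ∸ 16))
  where
  go : ∀ j → (16 + j) * (16 + j) * ((16 + j) * (16 + j)) ≤ 2 ^ (16 + j)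
  go zero    = ≤-refl
  go (suc j) = begin
    (17 + j) * (17 + j) * ((17 + j) * (17 + j))                  ≤⟨ m≤m+n _ (slack j) ⟩
    (17 + j) * (17 + j) * ((17 + j) * (17 + j)) + slack j        ≡⟨ expand j ⟩
    2 * ((16 + j) * (16 + j) * ((16 + j) * (16 + j)))            ≤⟨ *-monoʳ-≤ 2 (go j) ⟩
    2 * 2 ^ (16 + j)                                             ∎
    where
    open ≤-Reasoning
    slack : ℕ → ℕ
    slack j = j * j * j * j + 60 * j * j * j + 1338 * j * j + 13116 * j + 47551
    expand : ∀ j → (17 + j) * (17 + j) * ((17 + j) * (17 + j)) + (j * j * j * j + 60 * j * j * j + 1338 * j * j + 13116 * j + 47551)
                   ≡ 2 * ((16 + j) * (16 + j) * ((16 + j) * (16 + j)))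
    expand = solve-∀

2^[m+m]≤2^[n*[n∸1]] : ∀ {m k} → 1 ≤ m → 16 ≤ suc k → m + m ≤ suc k * suc k → π (m + m) ≤ k →
                      2 ^ (m + m) ≤ 2 ^ (suc k * k)
2^[m+m]≤2^[n*[n∸1]] {m} {k} 1≤m 16≤n 2m≤n² π≤k = begin
  2 ^ (m + m)                                ≡⟨ ^-distribˡ-+-* 2 m m ⟩
  2 ^ m * 2 ^ m                              ≤⟨ *-mono-≤ (chebyshev 1≤m) (chebyshev 1≤m) ⟩
  (m + m) ^ π (m + m) * (m + m) ^ π (m + m)  ≡⟨ ^-distribˡ-+-* (m + m) (π (m + m)) (π (m + m)) ⟨
  (m + m) ^ (π (m + m) + π (m + m))          ≤⟨ ^-monoˡ-≤ (π (m + m) + π (m + m)) 2m≤n² ⟩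
  (n * n) ^ (π (m + m) + π (m + m))          ≤⟨ ^-monoʳ-≤ (n * n) (+-mono-≤ π≤k π≤k) ⟩
  (n * n) ^ (k + k)                          ≡⟨ cong ((n * n) ^_) (cong (k +_) (+-identityʳ k)) ⟨
  (n * n) ^ (2 * k)                          ≡⟨ ^-*-assoc (n * n) 2 k ⟨
  ((n * n) ^ 2) ^ k                          ≡⟨ cong (λ x → (n * n * x) ^ k) (*-identityʳ (n * n)) ⟩
  (n * n * (n * n)) ^ k                      ≤⟨ ^-monoˡ-≤ k (n⁴≤2ⁿ n 16≤n) ⟩
  (2 ^ n) ^ k                                ≡⟨ ^-*-assoc 2 n k ⟩
  2 ^ (n * k)                                ∎
  where
  open ≤-Reasoning
  n = suc k

-- With 2m ∈ {n² - 1, n²} we have n (n - 1) < 2m, so π(2m) < n would contradict the bound above.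
n≤π[n²] : ∀ n → 16 ≤ n → n ≤ π (n * n)
n≤π[n²] n@(suc k) 16≤n = ≤-trans n≤π[2m] (π-mono-≤ 2m≤n²)
  where
  m = n * n / 2
  n²≡r+2m : n * n ≡ n * n % 2 + (m + m)
  n²≡r+2m = trans (m≡m%n+[m/n]*n (n * n) 2) (cong (n * n % 2 +_) (double m))
    where
    double : ∀ m → m * 2 ≡ m + m
    double = solve-∀
  2m≤n² : m + m ≤ n * n
  2m≤n² = subst (m + m ≤_) (sym n²≡r+2m) (m≤n+m (m + m) (n * n % 2))
  nk<2m : n * k < m + m
  nk<2m = +-cancelˡ-≤ 1 (suc (n * k)) (m + m) (begin
    2 + n * k             ≤⟨ +-monoˡ-≤ (n * k) (≤-trans (s≤s (s≤s z≤n)) 16≤n) ⟩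
    n + n * k             ≡⟨ *-suc n k ⟨
    n * n                 ≡⟨ n²≡r+2m ⟩
    n * n % 2 + (m + m)   ≤⟨ +-monoˡ-≤ (m + m) (s≤s⁻¹ (m%n<n (n * n) 2)) ⟩
    suc (m + m)           ∎)
    where open ≤-Reasoning
  1≤m : 1 ≤ m
  1≤m = m≥n⇒m/n>0 (≤-trans (≤-trans (s≤s (s≤s z≤n)) 16≤n) (m≤m*n n n))
  n≤π[2m] : n ≤ π (m + m)
  n≤π[2m] with n ≤? π (m + m)
  ... | yes n≤π = n≤π
  ... | no  n≰π = contradiction (^-monoʳ-< 2 (s≤s (s≤s z≤n)) nk<2m)
                                (≤⇒≯ (2^[m+m]≤2^[n*[n∸1]] 1≤m 16≤n 2m≤n² (s≤s⁻¹ (≰⇒> n≰π))))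

n≤π[1+n²] : ∀ n → n ≤ π (suc (n * n))
n≤π[1+n²] n with n <? 16
... | yes n<16 = lookup (toWitness {a? = all? (λ n → n ≤? π (suc (n * n))) (upTo 16)} _) (∈-upTo⁺ n<16)
... | no  n≮16 = ≤-trans (n≤π[n²] n (≮⇒≥ n≮16)) (π-mono-≤ (n≤1+n (n * n)))

2^≤2^⇔≤ : ∀ {a b} → 2 ^ a ≤ 2 ^ b ⇔ a ≤ b
2^≤2^⇔≤ = mk⇔ (λ 2ᵃ≤2ᵇ → ≮⇒≥ λ b<a → <⇒≱ (^-monoʳ-< 2 (s≤s (s≤s z≤n)) b<a) 2ᵃ≤2ᵇ) (^-monoʳ-≤ 2)

𝒩[4*a!]≤2ⁿ⇔π<n : ∀ a n → 𝒩 (4 * (a !)) {{4a!-nonZero a}} ≤ 2 ^ n ⇔ π a < n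
𝒩[4*a!]≤2ⁿ⇔π<n a n = subst (λ k → k ≤ 2 ^ n ⇔ π a < n) (sym 𝒩[4*a!]≡2^[1+πa]) 2^≤2^⇔≤
  where
  𝒩[4*a!]≡2^[1+πa] : 𝒩 (4 * (a !)) {{4a!-nonZero a}} ≡ 2 ^ suc (π a)
  𝒩[4*a!]≡2^[1+πa] = trans (𝒩≡sqrtsOfOne (4 * (a !)) {{4a!-nonZero a}}) (sqrtsOfOne[4*a!]≡2^[1+πa] a)

least-n≤π⇒IsNthPrime : ∀ {n q} → 1 ≤ n → ¬ π q < n → (∀ {a} → a < q → π a < n) → IsNthPrime n q
least-n≤π⇒IsNthPrime {n} {zero}   1≤n π0≮n _       = contradiction 1≤n π0≮n
least-n≤π⇒IsNthPrime {n} {suc q} 1≤n π[1+q]≮n below = step (prime? (suc q)) π[1+q]≮n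
  where
  πq<n : π q < n
  πq<n = below ≤-refl
  step : (1+q-prime? : Dec (Prime (suc q))) → ¬ π q + 𝟙 1+q-prime? < n → IsNthPrime n (suc q)
  step (yes 1+q-prime) π+1≮n = 1+q-prime , trans (length-filter-upTo prime? (suc q)) πq≡n∸1
    where
    πq≡n∸1 : π q ≡ n ∸ 1
    πq≡n∸1 = cong (_∸ 1) (≤-antisym πq<n (subst (n ≤_) (+-comm (π q) 1) (≮⇒≥ π+1≮n)))
  step (no _) π+0≮n = contradiction (subst (_< n) (sym (+-identityʳ (π q))) πq<n) π+0≮n

mainTheorem9 : (n : ℕ) → n ≥ 1 → IsNthPrime n (countA n)
mainTheorem9 n 1≤n with count-downClosed (λ a → π a <? n) (λ a≤b πb<n → ≤-<-trans (π-mono-≤ a≤b) πb<n)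
                                         (suc (n * n)) (≤⇒≯ (n≤π[1+n²] n))
... | πq≮n , below-q = subst (IsNthPrime n) (sym countA≡q) (least-n≤π⇒IsNthPrime 1≤n πq≮n below-q)
  where
  countA≡q : countA n ≡ count (λ a → π a <? n) (suc (n * n))
  countA≡q = trans (length-filter-upTo (λ a → 𝒩 (4 * (a !)) {{4a!-nonZero a}} ≤? 2 ^ n) (suc (n * n)))
                   (count-cong _ (λ a → π a <? n) (suc (n * n)) (λ {a} _ → 𝒩[4*a!]≤2ⁿ⇔π<n a n))
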